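{- Let $A,B,C,D\in\mathbb{Q}[t]$ with $C,D\ne0$, of degrees $s_a,s_b,s_c,s_d$ respectively (with degree $-\infty$ for the zero polynomial), and write $r_{c,s_c},r_{d,s_d}$ for the leading coefficients of $C,D$. Assume $s_d>s_b+1$, $s_d>s_c+1$ and $s_d>s_a$. Assume the equation $Dx'=A+Bx+Cx^2$ has a unique solution $x\in\mathbb{Q}((t^{ -1}))$ with $\deg x\ge1$. Then $\deg x=s_d-s_c-1$ and the leading coefficient of $x$ equals $\frac{(s_d-s_c-1)r_{d,s_d}}{r_{c,s_c}}$.
   Context: $\mathbb{Q}((t^{ -1}))$ is the field of formal Laurent series $\sum_{k\ge -d}c_kt^{ -k}$, $c_k\in\mathbb{Q}$; the degree of a nonzero series is the largest $d$ with $c_{ -d}\ne0$, and $c_{ -d}$ is its leading coefficient; $'$ denotes $d/dt$. -}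

module Defs where

open import Data.Nat using (ℕ; zero; suc)
open import Data.Integer as ℤ using (ℤ; +_; -[1+_]; _<_)
open import Data.Rational as ℚ using (ℚ; 0ℚ; _÷_; ≢-nonZero)
open import Data.Maybe using (Maybe; just; nothing)
open import Data.Product using (_×_)
open import Data.Unit using (⊤)
open import Relation.Binary.PropositionalEquality using (_≡_; _≢_)

-- A formal Laurent series  Σ_{n ≤ bound} coeff n · t^n  in  ℚ((t⁻¹)).
-- 'coeff n' is the coefficient of t^n; 'bound' is an (not necessarily sharp)
-- upper bound for the exponents occurring.
record Laurent : Set where
  constructor laurent
  field
    coeff : ℤ → ℚ
    bound : ℤ
open Laurent public

WF : Laurent → Set
WF x = ∀ n → bound x < n → coeff x n ≡ 0ℚ

IsPoly : Laurent → Set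
IsPoly x = WF x × (∀ n → n < + 0 → coeff x n ≡ 0ℚ)

pos : ℤ → ℕ
pos (+ n) = n
pos -[1+ n ] = 0

sumFrom : ℤ → ℕ → (ℤ → ℚ) → ℚ
sumFrom lo zero f = 0ℚ
sumFrom lo (suc k) f = f lo ℚ.+ sumFrom (lo ℤ.+ + 1) k f

_⊕_ : Laurent → Laurent → Laurent
x ⊕ y = laurent (λ n → coeff x n ℚ.+ coeff y n) (bound x ℤ.⊔ bound y)

-- Cauchy product: coefficient of t^n is Σ_{i=n-My}^{Nx} x_i y_{n-i}
_⊗_ : Laurent → Laurent → Laurent
x ⊗ y = laurent
  (λ n → sumFrom (n ℤ.- bound y) (pos (bound x ℤ.+ bound y ℤ.- n ℤ.+ + 1))
                 (λ i → coeff x i ℚ.* coeff y (n ℤ.- i)))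
  (bound x ℤ.+ bound y)

deriv : Laurent → Laurent
deriv x = laurent (λ n → (n ℤ.+ + 1) ℚ./ 1 ℚ.* coeff x (n ℤ.+ + 1)) (bound x ℤ.- + 1)

HasDegree : Laurent → ℤ → Set
HasDegree x d = (coeff x d ≢ 0ℚ) × (∀ m → d < m → coeff x m ≡ 0ℚ)

-- degree in ℤ ∪ {-∞}, with nothing = -∞ (zero series)
ℤ⊥ : Set
ℤ⊥ = Maybe ℤ

HasDegree⊥ : Laurent → ℤ⊥ → Set
HasDegree⊥ x nothing = ∀ n → coeff x n ≡ 0ℚ
HasDegree⊥ x (just d) = HasDegree x d

_+_<⊥_ : ℤ⊥ → ℤ → ℤ → Set
nothing + k <⊥ n = ⊤
just s + k <⊥ n = s ℤ.+ k < n

Solves : Laurent → Laurent → Laurent → Laurent → Laurent → Set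
Solves A B C D x = ∀ n → coeff (D ⊗ deriv x) n ≡ coeff (A ⊕ ((B ⊗ x) ⊕ (C ⊗ (x ⊗ x)))) n

DegGe1 : Laurent → Set
DegGe1 x = Σ' where
  open import Data.Product using (∃-syntax)
  Σ' = ∃[ d ] (+ 1 ℤ.≤ d × HasDegree x d)

divBy : ℚ → (q : ℚ) → q ≢ 0ℚ → ℚ
divBy p q h = _÷_ p q {{≢-nonZero h}}

-- Compare leading terms.  If deg x = m ≥ 1, then D x' has degree s_d + m − 1 and
-- C x² has degree s_c + 2m, while A and B x have degree below s_d + m − 1.  The
-- equation therefore forces the two leading terms to cancel each other: equal
-- degrees give m = s_d − s_c − 1, and equal leading coefficients give
-- r_d · m · a = r_c · a², i.e. a = m r_d / r_c.

module Submission where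

open import Defs
open import Data.Integer as ℤ using (ℤ; +_; -[1+_]; _<_)
open import Data.Rational as ℚ using (ℚ; 0ℚ)
open import Data.Product using (_×_; _,_; proj₁; proj₂)
open import Relation.Binary.PropositionalEquality using (_≡_)

open import Data.Nat using (zero; suc; s≤s; z≤n)
open import Data.Sum using (_⊎_; inj₁; inj₂)
open import Data.List using ([]; _∷_)
open import Data.Maybe using (just; nothing)
open import Data.Empty using (⊥-elim)
open import Relation.Nullary using (yes; no)
open import Relation.Binary.Definitions using (tri<; tri≈; tri>)
open import Relation.Binary.PropositionalEquality
  using (refl; sym; trans; cong; cong₂; subst; _≢_; ≢-sym; module ≡-Reasoning)
import Data.Integer.Properties as ℤP
import Data.Integer.GCD as ℤG
open import Data.Integer.Tactic.RingSolver using (solve; solve-∀)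
import Data.Rational.Properties as ℚP

*-cancelʳ-≢0 : ∀ {p q} r → r ≢ 0ℚ → p ℚ.* r ≡ q ℚ.* r → p ≡ q
*-cancelʳ-≢0 {p} {q} r r≢0 pr≡qr = begin
  p                           ≡⟨ sym (ℚP.*-identityʳ p) ⟩
  p ℚ.* ℚ.1ℚ                  ≡⟨ cong (p ℚ.*_) (sym r/r≡1) ⟩
  p ℚ.* (r ℚ.* r⁻¹)           ≡⟨ sym (ℚP.*-assoc p r r⁻¹) ⟩
  (p ℚ.* r) ℚ.* r⁻¹           ≡⟨ cong (ℚ._* r⁻¹) pr≡qr ⟩
  (q ℚ.* r) ℚ.* r⁻¹           ≡⟨ ℚP.*-assoc q r r⁻¹ ⟩
  q ℚ.* (r ℚ.* r⁻¹)           ≡⟨ cong (q ℚ.*_) r/r≡1 ⟩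
  q ℚ.* ℚ.1ℚ                  ≡⟨ ℚP.*-identityʳ q ⟩
  q                           ∎
  where
  open ≡-Reasoning
  r⁻¹ = ℚ.1/_ r {{ℚ.≢-nonZero r≢0}}
  r/r≡1 : r ℚ.* r⁻¹ ≡ ℚ.1ℚ
  r/r≡1 = ℚP.*-inverseʳ r {{ℚ.≢-nonZero r≢0}}

*-≢0 : ∀ {p q} → p ≢ 0ℚ → q ≢ 0ℚ → p ℚ.* q ≢ 0ℚ
*-≢0 {p} {q} p≢0 q≢0 pq≡0 =
  p≢0 (*-cancelʳ-≢0 q q≢0 (trans pq≡0 (sym (ℚP.*-zeroˡ q))))

i≢0⇒i/1≢0 : ∀ i → i ≢ + 0 → i ℚ./ 1 ≢ 0ℚ
i≢0⇒i/1≢0 i i≢0 i/1≡0 =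
  i≢0 (trans (sym (ℚP.↥-/ i 1)) (cong (λ q → ℚ.↥ q ℤ.* ℤG.gcd i (+ 1)) i/1≡0))

leading-balance : ∀ {a c d k} (c≢0 : c ≢ 0ℚ) → a ≢ 0ℚ →
                  d ℚ.* (k ℚ.* a) ≡ c ℚ.* (a ℚ.* a) → a ≡ divBy (k ℚ.* d) c c≢0
leading-balance {a} {c} {d} {k} c≢0 a≢0 balance = *-cancelʳ-≢0 c c≢0 (begin
  a ℚ.* c                     ≡⟨ ℚP.*-comm a c ⟩
  c ℚ.* a                     ≡⟨ sym kd≡ca ⟩
  k ℚ.* d                     ≡⟨ sym (ℚP.*-identityʳ (k ℚ.* d)) ⟩
  (k ℚ.* d) ℚ.* ℚ.1ℚ          ≡⟨ cong ((k ℚ.* d) ℚ.*_) (sym (ℚP.*-inverseˡ c {{ℚ.≢-nonZero c≢0}})) ⟩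
  (k ℚ.* d) ℚ.* (c⁻¹ ℚ.* c)   ≡⟨ sym (ℚP.*-assoc (k ℚ.* d) c⁻¹ c) ⟩
  ((k ℚ.* d) ℚ.* c⁻¹) ℚ.* c   ∎)
  where
  open ≡-Reasoning
  c⁻¹ = ℚ.1/_ c {{ℚ.≢-nonZero c≢0}}
  kd≡ca : k ℚ.* d ≡ c ℚ.* a
  kd≡ca = *-cancelʳ-≢0 a a≢0 (begin
    (k ℚ.* d) ℚ.* a           ≡⟨ cong (ℚ._* a) (ℚP.*-comm k d) ⟩
    (d ℚ.* k) ℚ.* a           ≡⟨ ℚP.*-assoc d k a ⟩
    d ℚ.* (k ℚ.* a)           ≡⟨ balance ⟩
    c ℚ.* (a ℚ.* a)           ≡⟨ sym (ℚP.*-assoc c a a) ⟩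
    (c ℚ.* a) ℚ.* a           ∎)

sumFrom-zero : ∀ lo k f → (∀ i → lo ℤ.≤ i → f i ≡ 0ℚ) → sumFrom lo k f ≡ 0ℚ
sumFrom-zero lo zero    f f≡0 = refl
sumFrom-zero lo (suc k) f f≡0 =
  trans (cong₂ ℚ._+_ (f≡0 lo ℤP.≤-refl)
                     (sumFrom-zero (lo ℤ.+ + 1) k f
                        (λ i lo+1≤i → f≡0 i (ℤP.≤-trans (ℤP.i≤i+j lo (+ 1)) lo+1≤i))))
        (ℚP.+-identityˡ 0ℚ)

sumFrom-single : ∀ lo k f {i₀} → lo ℤ.≤ i₀ → i₀ < lo ℤ.+ + k →
                 (∀ i → i ≢ i₀ → f i ≡ 0ℚ) → sumFrom lo k f ≡ f i₀
sumFrom-single lo zero f lo≤i₀ i₀<lo+0 f≡0 =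
  ⊥-elim (ℤP.<-irrefl refl (ℤP.≤-<-trans lo≤i₀ (subst (_ <_) (ℤP.+-identityʳ lo) i₀<lo+0)))
sumFrom-single lo (suc k) f {i₀} lo≤i₀ i₀<lo+k f≡0 with lo ℤP.≟ i₀
... | yes refl =
  trans (cong (f lo ℚ.+_) (sumFrom-zero (lo ℤ.+ + 1) k f
          (λ i lo+1≤i → f≡0 i (λ { refl → ℤP.<-irrefl refl (ℤP.suc[i]≤j⇒i<j
             (subst (ℤ._≤ lo) (ℤP.+-comm lo (+ 1)) lo+1≤i)) }))))
        (ℚP.+-identityʳ (f lo))
... | no lo≢i₀ =
  trans (cong₂ ℚ._+_ (f≡0 lo lo≢i₀)
          (sumFrom-single (lo ℤ.+ + 1) k f
            (subst (ℤ._≤ i₀) (ℤP.+-comm (+ 1) lo) (ℤP.i<j⇒suc[i]≤j (ℤP.≤∧≢⇒< lo≤i₀ lo≢i₀)))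
            (subst (i₀ <_) (sym (ℤP.+-assoc lo (+ 1) (+ k))) i₀<lo+k) f≡0))
        (ℚP.+-identityˡ (f i₀))

VanishesAbove : Laurent → ℤ → Set
VanishesAbove x e = ∀ n → e < n → coeff x n ≡ 0ℚ

hasDegree⇒≤bound : ∀ {x d} → WF x → HasDegree x d → d ℤ.≤ bound x
hasDegree⇒≤bound {x} {d} wf (xd≢0 , _) = ℤP.≮⇒≥ (λ bound<d → xd≢0 (wf d bound<d))

product-term-vanishes : ∀ {x y e₁ e₂} n i → VanishesAbove x e₁ → VanishesAbove y e₂ →
                        e₁ < i ⊎ e₂ < n ℤ.- i → coeff x i ℚ.* coeff y (n ℤ.- i) ≡ 0ℚ
product-term-vanishes {x} {y} n i x-top y-top (inj₁ e₁<i) =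
  trans (cong (ℚ._* coeff y (n ℤ.- i)) (x-top i e₁<i)) (ℚP.*-zeroˡ (coeff y (n ℤ.- i)))
product-term-vanishes {x} {y} n i x-top y-top (inj₂ e₂<n-i) =
  trans (cong (coeff x i ℚ.*_) (y-top (n ℤ.- i) e₂<n-i)) (ℚP.*-zeroʳ (coeff x i))

i+j<k⇒i<k-j : ∀ {i j k} → i ℤ.+ j < k → i < k ℤ.- j
i+j<k⇒i<k-j {i} {j} {k} i+j<k = begin-strict
  i                  ≡⟨ solve (i ∷ j ∷ []) ⟩
  i ℤ.+ j ℤ.- j      <⟨ ℤP.+-monoˡ-< (ℤ.- j) i+j<k ⟩
  k ℤ.- j            ∎
  where open ℤP.≤-Reasoning

⊗-vanishesAbove : ∀ {x y e₁ e₂} → VanishesAbove x e₁ → VanishesAbove y e₂ →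
                  VanishesAbove (x ⊗ y) (e₁ ℤ.+ e₂)
⊗-vanishesAbove {x} {y} {e₁} {e₂} x-top y-top n e₁+e₂<n =
  sumFrom-zero (n ℤ.- bound y) (pos (bound x ℤ.+ bound y ℤ.- n ℤ.+ + 1)) term
               (λ i _ → product-term-vanishes {x} {y} n i x-top y-top (split i))
  where
  term = λ i → coeff x i ℚ.* coeff y (n ℤ.- i)
  split : ∀ i → e₁ < i ⊎ e₂ < n ℤ.- i
  split i with i ℤP.≤? e₁
  ... | no  i≰e₁ = inj₁ (ℤP.≰⇒> i≰e₁)
  ... | yes i≤e₁ = inj₂ (i+j<k⇒i<k-j (ℤP.≤-<-trans (ℤP.+-monoʳ-≤ e₂ i≤e₁)
                                             (subst (_< n) (ℤP.+-comm e₁ e₂) e₁+e₂<n)))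

i≤pos[i] : ∀ i → i ℤ.≤ + pos i
i≤pos[i] (+ n)    = ℤP.≤-refl
i≤pos[i] -[1+ n ] = ℤ.-≤+

-- The Cauchy sum for the coefficient of t^(p+q) runs over i ∈ [p + q − M, N]; it contains p.
diagonal-in-range : ∀ {p q N M} → p ℤ.≤ N → q ℤ.≤ M →
                    p ℤ.+ q ℤ.- M ℤ.≤ p × p < p ℤ.+ q ℤ.- M ℤ.+ (N ℤ.+ M ℤ.- (p ℤ.+ q) ℤ.+ + 1)
diagonal-in-range {p} {q} {N} {M} p≤N q≤M = lower , upper
  where
  open ℤP.≤-Reasoning
  lower = begin
    p ℤ.+ q ℤ.- M    ≤⟨ ℤP.+-monoˡ-≤ (ℤ.- M) (ℤP.+-monoʳ-≤ p q≤M) ⟩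
    p ℤ.+ M ℤ.- M    ≡⟨ solve (p ∷ M ∷ []) ⟩
    p                ∎
  upper = begin-strict
    p                ≡⟨ solve (p ∷ []) ⟩
    p ℤ.+ + 0        <⟨ ℤP.+-mono-≤-< p≤N (ℤ.+<+ (s≤s z≤n)) ⟩
    N ℤ.+ + 1        ≡⟨ solve (p ∷ q ∷ N ∷ M ∷ []) ⟩
    p ℤ.+ q ℤ.- M ℤ.+ (N ℤ.+ M ℤ.- (p ℤ.+ q) ℤ.+ + 1) ∎

⊗-coeff-top : ∀ {x y p q} → WF x → WF y → HasDegree x p → HasDegree y q →
              coeff (x ⊗ y) (p ℤ.+ q) ≡ coeff x p ℚ.* coeff y q
⊗-coeff-top {x} {y} {p} {q} wx wy hx@(_ , x-top) hy@(_ , y-top) = begin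
  sumFrom lo (pos len) term  ≡⟨ sumFrom-single lo (pos len) term lo≤p p<lo+len off-diagonal ⟩
  term p                     ≡⟨ cong (λ j → coeff x p ℚ.* coeff y j) (q-index p q) ⟩
  coeff x p ℚ.* coeff y q    ∎
  where
  open ≡-Reasoning
  lo = p ℤ.+ q ℤ.- bound y
  len = bound x ℤ.+ bound y ℤ.- (p ℤ.+ q) ℤ.+ + 1
  term = λ i → coeff x i ℚ.* coeff y (p ℤ.+ q ℤ.- i)
  q-index : ∀ p q → p ℤ.+ q ℤ.- p ≡ q
  q-index = solve-∀
  in-range = diagonal-in-range (hasDegree⇒≤bound wx hx) (hasDegree⇒≤bound wy hy)
  lo≤p = proj₁ in-range
  p<lo+len : p < lo ℤ.+ + pos len
  p<lo+len = ℤP.<-≤-trans (proj₂ in-range) (ℤP.+-monoʳ-≤ lo (i≤pos[i] len))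
  off-diagonal : ∀ i → i ≢ p → term i ≡ 0ℚ
  off-diagonal i i≢p = product-term-vanishes {x} {y} (p ℤ.+ q) i x-top y-top (side (ℤP.<-cmp i p))
    where
    side : _ → p < i ⊎ q < p ℤ.+ q ℤ.- i
    side (tri< i<p _ _) = inj₂ (i+j<k⇒i<k-j (subst (q ℤ.+ i <_) (ℤP.+-comm q p) (ℤP.+-monoʳ-< q i<p)))
    side (tri≈ _ i≡p _) = ⊥-elim (i≢p i≡p)
    side (tri> _ _ p<i) = inj₁ p<i

⊗-hasDegree : ∀ {x y p q} → WF x → WF y → HasDegree x p → HasDegree y q →
              HasDegree (x ⊗ y) (p ℤ.+ q)
⊗-hasDegree {x} {y} wx wy hx@(xp≢0 , x-top) hy@(yq≢0 , y-top) =
  (λ top≡0 → *-≢0 xp≢0 yq≢0 (trans (sym (⊗-coeff-top {x} {y} wx wy hx hy)) top≡0)) ,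
  ⊗-vanishesAbove {x} {y} x-top y-top

i-1+1≡i : ∀ i → i ℤ.- + 1 ℤ.+ + 1 ≡ i
i-1+1≡i = solve-∀

deriv-vanishesAbove : ∀ {x e} → VanishesAbove x e → VanishesAbove (deriv x) (e ℤ.- + 1)
deriv-vanishesAbove {x} {e} x-top n e-1<n =
  trans (cong ((n ℤ.+ + 1) ℚ./ 1 ℚ.*_) (x-top (n ℤ.+ + 1) e<n+1)) (ℚP.*-zeroʳ ((n ℤ.+ + 1) ℚ./ 1))
  where
  e<n+1 : e < n ℤ.+ + 1
  e<n+1 = subst (_< n ℤ.+ + 1) (i-1+1≡i e) (ℤP.+-monoˡ-< (+ 1) e-1<n)

deriv-coeff : ∀ x m → coeff (deriv x) (m ℤ.- + 1) ≡ (m ℚ./ 1) ℚ.* coeff x m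
deriv-coeff x m = cong (λ k → (k ℚ./ 1) ℚ.* coeff x k) (i-1+1≡i m)

deriv-hasDegree : ∀ {x m} → m ≢ + 0 → HasDegree x m → HasDegree (deriv x) (m ℤ.- + 1)
deriv-hasDegree {x} {m} m≢0 (xm≢0 , x-top) =
  (λ top≡0 → *-≢0 (i≢0⇒i/1≢0 m m≢0) xm≢0 (trans (sym (deriv-coeff x m)) top≡0)) ,
  deriv-vanishesAbove {x} x-top

hasDegree⊥-vanishesAbove : ∀ {x s k n} → HasDegree⊥ x s → s + k <⊥ n →
                           VanishesAbove x (n ℤ.- k ℤ.- + 1)
hasDegree⊥-vanishesAbove {s = nothing} x≡0 _ j _ = x≡0 j
hasDegree⊥-vanishesAbove {x} {just s} {k} {n} (_ , x-top) s+k<n j n-k-1<j =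
  x-top j (begin-strict
    s                            <⟨ i+j<k⇒i<k-j s+k<n ⟩
    n ℤ.- k                      ≡⟨ solve (n ∷ k ∷ []) ⟩
    + 1 ℤ.+ (n ℤ.- k ℤ.- + 1)    ≤⟨ ℤP.i<j⇒suc[i]≤j n-k-1<j ⟩
    j                            ∎)
  where open ℤP.≤-Reasoning

vanishesAbove-mono : ∀ {x e e′} → e ℤ.≤ e′ → VanishesAbove x e → VanishesAbove x e′
vanishesAbove-mono e≤e′ x-top n e′<n = x-top n (ℤP.≤-<-trans e≤e′ e′<n)

⊕-coeff-vanishingˡ : ∀ {w e n} z → VanishesAbove w e → e < n → coeff (w ⊕ z) n ≡ coeff z n
⊕-coeff-vanishingˡ {w} {e} {n} z w-top e<n =
  trans (cong (ℚ._+ coeff z n) (w-top n e<n)) (ℚP.+-identityˡ (coeff z n))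

Solves⇒tails-agree : ∀ {A B C D x e} → Solves A B C D x →
                     VanishesAbove A e → VanishesAbove (B ⊗ x) e →
                     ∀ n → e < n → coeff (D ⊗ deriv x) n ≡ coeff (C ⊗ (x ⊗ x)) n
Solves⇒tails-agree {A} {B} {C} {D} {x} solves A-top Bx-top n e<n = begin
  coeff (D ⊗ deriv x) n                         ≡⟨ solves n ⟩
  coeff (A ⊕ ((B ⊗ x) ⊕ (C ⊗ (x ⊗ x)))) n
    ≡⟨ ⊕-coeff-vanishingˡ {A} ((B ⊗ x) ⊕ (C ⊗ (x ⊗ x))) A-top e<n ⟩
  coeff ((B ⊗ x) ⊕ (C ⊗ (x ⊗ x))) n
    ≡⟨ ⊕-coeff-vanishingˡ {B ⊗ x} (C ⊗ (x ⊗ x)) Bx-top e<n ⟩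
  coeff (C ⊗ (x ⊗ x)) n                         ∎
  where open ≡-Reasoning

hasDegree-unique-above : ∀ {x y p q e} → HasDegree x p → HasDegree y q → e < p →
                         (∀ n → e < n → coeff x n ≡ coeff y n) → p ≡ q
hasDegree-unique-above {p = p} {q} (xp≢0 , x-top) (yq≢0 , y-top) e<p agree with ℤP.<-cmp p q
... | tri< p<q _ _ = ⊥-elim (yq≢0 (trans (sym (agree q (ℤP.<-trans e<p p<q))) (x-top q p<q)))
... | tri≈ _ p≡q _ = p≡q
... | tri> _ _ q<p = ⊥-elim (xp≢0 (trans (agree p e<p) (y-top p q<p)))

degrees-balance : ∀ {sc sd m} → sd ℤ.+ (m ℤ.- + 1) ≡ sc ℤ.+ (m ℤ.+ m) → m ≡ sd ℤ.- sc ℤ.- + 1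
degrees-balance {sc} {sd} {m} balance = begin
  m                                  ≡⟨ solve (sc ∷ m ∷ []) ⟩
  sc ℤ.+ (m ℤ.+ m) ℤ.- sc ℤ.- m      ≡⟨ cong (λ k → k ℤ.- sc ℤ.- m) (sym balance) ⟩
  sd ℤ.+ (m ℤ.- + 1) ℤ.- sc ℤ.- m    ≡⟨ solve (sd ∷ sc ∷ m ∷ []) ⟩
  sd ℤ.- sc ℤ.- + 1                  ∎
  where open ≡-Reasoning

leading-terms-cancel : ∀ {A B C D x sc sd m e} → WF C → WF D → WF x →
                       HasDegree C sc → HasDegree D sd → HasDegree x m → m ≢ + 0 →
                       Solves A B C D x → VanishesAbove A e → VanishesAbove (B ⊗ x) e →
                       e < sd ℤ.+ (m ℤ.- + 1) →
                       sd ℤ.+ (m ℤ.- + 1) ≡ sc ℤ.+ (m ℤ.+ m) ×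
                       coeff D sd ℚ.* ((m ℚ./ 1) ℚ.* coeff x m) ≡ coeff C sc ℚ.* (coeff x m ℚ.* coeff x m)
leading-terms-cancel {A} {B} {C} {D} {x} {sc} {sd} {m} {e} wC wD wx hC hD hx m≢0 solves A-top Bx-top e<top =
  degrees-agree , (begin
    coeff D sd ℚ.* ((m ℚ./ 1) ℚ.* coeff x m)     ≡⟨ cong (coeff D sd ℚ.*_) (sym (deriv-coeff x m)) ⟩
    coeff D sd ℚ.* coeff (deriv x) (m ℤ.- + 1)   ≡⟨ sym (⊗-coeff-top wD wx′ hD hx′) ⟩
    coeff (D ⊗ deriv x) (sd ℤ.+ (m ℤ.- + 1))     ≡⟨ tails-agree _ e<top ⟩
    coeff (C ⊗ (x ⊗ x)) (sd ℤ.+ (m ℤ.- + 1))     ≡⟨ cong (coeff (C ⊗ (x ⊗ x))) degrees-agree ⟩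
    coeff (C ⊗ (x ⊗ x)) (sc ℤ.+ (m ℤ.+ m))       ≡⟨ ⊗-coeff-top wC wx² hC hx² ⟩
    coeff C sc ℚ.* coeff (x ⊗ x) (m ℤ.+ m)       ≡⟨ cong (coeff C sc ℚ.*_) (⊗-coeff-top wx wx hx hx) ⟩
    coeff C sc ℚ.* (coeff x m ℚ.* coeff x m)     ∎)
  where
  open ≡-Reasoning
  wx′ : WF (deriv x)
  wx′ = deriv-vanishesAbove {x} wx
  hx′ : HasDegree (deriv x) (m ℤ.- + 1)
  hx′ = deriv-hasDegree {x} m≢0 hx
  wx² : WF (x ⊗ x)
  wx² = ⊗-vanishesAbove {x} {x} wx wx
  hx² : HasDegree (x ⊗ x) (m ℤ.+ m)
  hx² = ⊗-hasDegree wx wx hx hx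
  tails-agree : ∀ n → e < n → coeff (D ⊗ deriv x) n ≡ coeff (C ⊗ (x ⊗ x)) n
  tails-agree = Solves⇒tails-agree {A} {B} {C} {D} {x} solves A-top Bx-top
  degrees-agree : sd ℤ.+ (m ℤ.- + 1) ≡ sc ℤ.+ (m ℤ.+ m)
  degrees-agree = hasDegree-unique-above {D ⊗ deriv x} {C ⊗ (x ⊗ x)}
    (⊗-hasDegree wD wx′ hD hx′) (⊗-hasDegree wC wx² hC hx²) e<top tails-agree

subleading-bounds : ∀ {sd m} → + 1 ℤ.≤ m →
                    sd ℤ.- + 0 ℤ.- + 1 ℤ.≤ sd ℤ.- + 1 ℤ.- + 1 ℤ.+ m ×
                    sd ℤ.- + 1 ℤ.- + 1 ℤ.+ m < sd ℤ.+ (m ℤ.- + 1)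
subleading-bounds {sd} {m} 1≤m = A-bound , ℤP.i≤pred[j]⇒i<j (ℤP.≤-reflexive Bx-bound)
  where
  open ℤP.≤-Reasoning
  A-bound = begin
    sd ℤ.- + 0 ℤ.- + 1                ≡⟨ solve (sd ∷ []) ⟩
    sd ℤ.- + 1 ℤ.- + 1 ℤ.+ + 1        ≤⟨ ℤP.+-monoʳ-≤ (sd ℤ.- + 1 ℤ.- + 1) 1≤m ⟩
    sd ℤ.- + 1 ℤ.- + 1 ℤ.+ m          ∎
  Bx-bound : sd ℤ.- + 1 ℤ.- + 1 ℤ.+ m ≡ ℤ.- + 1 ℤ.+ (sd ℤ.+ (m ℤ.- + 1))
  Bx-bound = solve (sd ∷ m ∷ [])

lemma5 : (A B C D : Laurent) → IsPoly A → IsPoly B → IsPoly C → IsPoly D →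
    (sa sb : ℤ⊥) (sc sd : ℤ) →
    HasDegree⊥ A sa → HasDegree⊥ B sb →
    (hc : HasDegree C sc) → HasDegree D sd →
    sb + + 1 <⊥ sd → sc ℤ.+ + 1 < sd → sa + + 0 <⊥ sd →
    (x : Laurent) → WF x → DegGe1 x → Solves A B C D x →
    ((y : Laurent) → WF y → DegGe1 y → Solves A B C D y → ∀ n → coeff y n ≡ coeff x n) →
    HasDegree x (sd ℤ.- sc ℤ.- + 1) ×
    coeff x (sd ℤ.- sc ℤ.- + 1) ≡
    divBy (((sd ℤ.- sc ℤ.- + 1) ℚ./ 1) ℚ.* coeff D sd) (coeff C sc) (proj₁ hc)
lemma5 A B C D _ _ (wC , _) (wD , _) _ _ sc sd hA hB hC hD sb+1<sd _ sa<sd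
       x wx (m , 1≤m , hx) solves _ =
  subst Conclusion (degrees-balance {sc} {sd} (proj₁ cancel))
        (hx , leading-balance {d = coeff D sd} {k = m ℚ./ 1} (proj₁ hC) (proj₁ hx) (proj₂ cancel))
  where
  Conclusion : ℤ → Set
  Conclusion k = HasDegree x k × coeff x k ≡ divBy ((k ℚ./ 1) ℚ.* coeff D sd) (coeff C sc) (proj₁ hC)
  bounds : sd ℤ.- + 0 ℤ.- + 1 ℤ.≤ sd ℤ.- + 1 ℤ.- + 1 ℤ.+ m × sd ℤ.- + 1 ℤ.- + 1 ℤ.+ m < sd ℤ.+ (m ℤ.- + 1)
  bounds = subleading-bounds {sd} 1≤m
  cancel : sd ℤ.+ (m ℤ.- + 1) ≡ sc ℤ.+ (m ℤ.+ m) ×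
           coeff D sd ℚ.* ((m ℚ./ 1) ℚ.* coeff x m) ≡ coeff C sc ℚ.* (coeff x m ℚ.* coeff x m)
  cancel = leading-terms-cancel {A} {B} {C} {D} {x} wC wD wx hC hD hx
             (≢-sym (ℤP.<⇒≢ (ℤP.suc[i]≤j⇒i<j 1≤m))) solves
             (vanishesAbove-mono {A} (proj₁ bounds) (hasDegree⊥-vanishesAbove hA sa<sd))
             (⊗-vanishesAbove {B} {x} (hasDegree⊥-vanishesAbove hB sb+1<sd) (proj₂ hx))
             (proj₂ bounds)
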